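{- Let $n\ge 2$ and $k$ be positive integers with $k\ge n-1$, and let $x,y,z$ be vertices of $K(2n+k,n)$ such that $(x\cup y\cup z)\setminus(x\cap y\cap z)=\{h,i,j\}$ for pairwise distinct elements $h,i,j$, where $h$ belongs to $x$ only, $i$ belongs to $y$ only, and $j$ belongs to $z$ only (equivalently, $x=C\cup\{h\}$, $y=C\cup\{i\}$, $z=C\cup\{j\}$ for some $(n-1)$-set $C$). Then $\{x,y,z\}$ is a geodetic hull set of $K(2n+k,n)$.
   Context: For positive integers $n,k$, the Kneser graph $K(2n+k,n)$ has as vertex set all $n$-element subsets of $\{1,\ldots,2n+k\}$, two vertices $u,v$ being adjacent iff $u\cap v=\emptyset$. For vertices $u,v$, $I[u,v]$ is the set of all vertices on some shortest $u$–$v$ path; for $W\subseteq V$, $I[W]=\bigcup_{u,v\in W}I[u,v]$. $W$ is geodetically convex if $I[W]=W$; the geodetic hull $H[W]$ is the smallest geodetically convex set containing $W$; $W$ is a geodetic hull set if $H[W]=V$. -}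

module Defs where

open import Level using (Level; 0ℓ) renaming (suc to lsuc)
open import Data.Nat using (ℕ; suc; _+_; _≤_)
open import Data.Fin using (Fin)
open import Data.Fin.Subset using (Subset; _∈_; _∩_; ∣_∣)
open import Data.Product using (Σ; ∃; ∃₂; _×_; proj₁)
open import Relation.Binary.PropositionalEquality using (_≡_)
open import Relation.Nullary using (¬_)
open import Data.Sum using (_⊎_)

-- Vertices of the Kneser graph K(N, n): n-element subsets of {1..N} (here Fin N).
KVertex : ℕ → ℕ → Set
KVertex N n = Σ (Subset N) (λ s → ∣ s ∣ ≡ n)

Adj : {N n : ℕ} → KVertex N n → KVertex N n → Set
Adj u v = ∀ e → ¬ (e ∈ proj₁ u × e ∈ proj₁ v)

data Walk {N n : ℕ} : KVertex N n → KVertex N n → ℕ → Set where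
  here : ∀ {u} → Walk u u 0
  step : ∀ {u v w ℓ} → Adj u v → Walk v w ℓ → Walk u w (suc ℓ)

-- w lies on some shortest u–v path: there is a u–v walk through w
-- (a u–w walk of length a followed by a w–v walk of length b)
-- whose length a + b is at most the length of every u–v walk.
InInterval : {N n : ℕ} → KVertex N n → KVertex N n → KVertex N n → Set
InInterval u v w =
  ∃₂ λ a b → Walk u w a × Walk w v b × (∀ m → Walk u v m → a + b ≤ m)

VSet : ℕ → ℕ → Set₁
VSet N n = KVertex N n → Set

Interval : {N n : ℕ} → VSet N n → VSet N n
Interval W w = ∃₂ λ u v → W u × W v × InInterval u v w

-- W is geodetically convex iff I[W] = W (W ⊆ I[W] always holds, as u ∈ I[u,u];
-- we state both inclusions as in the definition).
Convex : {N n : ℕ} → VSet N n → Set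
Convex W = (∀ w → Interval W w → W w) × (∀ w → W w → Interval W w)

-- Geodetic hull H[W]: the smallest convex set containing W,
-- i.e. the intersection of all convex supersets of W.
Hull : {N n : ℕ} → VSet N n → KVertex N n → Set₁
Hull {N} {n} W x = (C : VSet N n) → Convex C → (∀ w → W w → C w) → C x

GeodeticHullSet : {N n : ℕ} → VSet N n → Set₁
GeodeticHullSet W = ∀ x → Hull W x

Three : {N n : ℕ} → KVertex N n → KVertex N n → KVertex N n → VSet N n
Three x y z w = (w ≡ x) ⊎ ((w ≡ y) ⊎ (w ≡ z))

-- Write x = K ∪ {h}, y = K ∪ {i}, z = K ∪ {j} with |K| = n − 1, and let C be a convex set
-- containing x, y, z. Two distinct intersecting vertices are at distance 2, so C contains every
-- common neighbour of two such vertices of C. Applied to the pairs (x, y) and (x, z), and to x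
-- and a vertex obtained from (y, z), this puts every vertex disjoint from x into C, and
-- symmetrically every vertex disjoint from y. A vertex w meeting K is a common neighbour of two
-- n-subsets of an (n + 1)-set avoiding w ∪ K, chosen to miss h or i; a vertex containing h but
-- missing K is reached the same way from an (n + 1)-set containing one element of K; every other
-- vertex is disjoint from x. The hypothesis k ≥ n − 1 is what leaves room for these auxiliary
-- sets among the 2n + k points.
module Submission where

open import Defs
open import Data.Nat using (ℕ; _+_; _*_; _∸_; _≤_)
open import Data.Fin using (Fin)
open import Data.Fin.Subset using (_∈_; _∉_; _∪_; _∩_; _─_; ⁅_⁆)
open import Data.Product using (proj₁)
open import Relation.Binary.PropositionalEquality using (_≡_; _≢_)

open import Data.Nat using (zero; suc; _<_; z≤n; s≤s)
open import Data.Nat.Properties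
  using (≤-trans; ≤-reflexive; +-identityʳ; +-suc; +-comm; +-monoʳ-≤; +-monoʳ-<; +-monoˡ-≤; m≤m+n;
         m+n≤o⇒m≤o∸n; n≤1+n; m∸n+n≡m; <⇒≱; suc-injective; module ≤-Reasoning)
open import Data.Fin using (zero; suc; _≟_)
open import Data.Fin.Subset
  using (Subset; inside; outside; ⊥; ∁; _-_; _⊆_; ∣_∣; Nonempty; Empty)
open import Data.Fin.Subset.Properties
  using (_∈?_; ∣⊥∣≡0; ∣⁅x⁆∣≡1; ∣∁p∣≡n∸∣p∣; p⊆q⇒∣p∣≤∣q∣; x∈p⇒∣p-x∣<∣p∣;
         p─⊥≡p; ∪-identityʳ; ∉⊥; nonempty?; in⊆in; out⊆; x∈⁅x⁆; x∈⁅y⁆⇒x≡y; x∉⁅y⁆⇒x≢y;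
         x∈∁p⇒x∉p; x∈p∩q⁺; x∈p∩q⁻; x∈p∪q⁺; x∈p∪q⁻; x∈p∧x∉q⇒x∈p─q; x∈p∧x≢y⇒x∈p-y; p─q⊆p)
open import Data.Fin.Properties using (any?)
open import Data.Vec using ([]; _∷_; here; there)
open import Data.Product using (∃; _×_; _,_; proj₂)
open import Data.Sum using (_⊎_; inj₁; inj₂)
open import Data.Empty using (⊥-elim)
open import Function using (_∘_)
open import Relation.Nullary using (Dec; yes; no; ¬?)
open import Relation.Nullary.Decidable using (_×-dec_)
open import Relation.Binary.PropositionalEquality using (refl; sym; trans; cong; cong₂; subst)

private
  variable
    N n : ℕ

∈∉⇒≢ : ∀ {p : Subset N} {e a} → e ∈ p → a ∉ p → e ≢ a
∈∉⇒≢ e∈p a∉p refl = a∉p e∈p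

x∈p─q⇒x∉q : ∀ (p q : Subset N) {x} → x ∈ p ─ q → x ∉ q
x∈p─q⇒x∉q (_ ∷ p) (inside  ∷ q) {zero}  ()
x∈p─q⇒x∉q (_ ∷ p) (outside ∷ q) {zero}  _         ()
x∈p─q⇒x∉q (_ ∷ p) (_       ∷ q) {suc x} (there m) (there n) = x∈p─q⇒x∉q p q m n

x∈p-y⁻ : ∀ {p : Subset N} {x y} → x ∈ p - y → x ∈ p × x ≢ y
x∈p-y⁻ {p = p} {y = y} m = p─q⊆p p ⁅ y ⁆ m , x∉⁅y⁆⇒x≢y (x∈p─q⇒x∉q p ⁅ y ⁆ m)

x∉p-x : ∀ {p : Subset N} {x} → x ∉ p - x
x∉p-x m = proj₂ (x∈p-y⁻ m) refl

x∈p∪⁅y⁆⁻ : ∀ {p : Subset N} {x y} → x ∈ p ∪ ⁅ y ⁆ → x ∈ p ⊎ x ≡ y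
x∈p∪⁅y⁆⁻ {p = p} {y = y} m with x∈p∪q⁻ p ⁅ y ⁆ m
... | inj₁ x∈p   = inj₁ x∈p
... | inj₂ x∈⁅y⁆ = inj₂ (x∈⁅y⁆⇒x≡y y x∈⁅y⁆)

[p∪⁅x⁆]-x⊆p : ∀ {p : Subset N} {x} → (p ∪ ⁅ x ⁆) - x ⊆ p
[p∪⁅x⁆]-x⊆p m with x∈p-y⁻ m
... | e∈p∪⁅x⁆ , e≢x with x∈p∪⁅y⁆⁻ e∈p∪⁅x⁆
...   | inj₁ e∈p = e∈p
...   | inj₂ e≡x = ⊥-elim (e≢x e≡x)

∣p∪q∣+∣p∩q∣≡∣p∣+∣q∣ : ∀ (p q : Subset N) → ∣ p ∪ q ∣ + ∣ p ∩ q ∣ ≡ ∣ p ∣ + ∣ q ∣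
∣p∪q∣+∣p∩q∣≡∣p∣+∣q∣ []            []            = refl
∣p∪q∣+∣p∩q∣≡∣p∣+∣q∣ (inside  ∷ p) (inside  ∷ q) =
  cong suc (trans (+-suc _ _) (trans (cong suc (∣p∪q∣+∣p∩q∣≡∣p∣+∣q∣ p q)) (sym (+-suc _ _))))
∣p∪q∣+∣p∩q∣≡∣p∣+∣q∣ (inside  ∷ p) (outside ∷ q) = cong suc (∣p∪q∣+∣p∩q∣≡∣p∣+∣q∣ p q)
∣p∪q∣+∣p∩q∣≡∣p∣+∣q∣ (outside ∷ p) (inside  ∷ q) =
  trans (cong suc (∣p∪q∣+∣p∩q∣≡∣p∣+∣q∣ p q)) (sym (+-suc _ _))
∣p∪q∣+∣p∩q∣≡∣p∣+∣q∣ (outside ∷ p) (outside ∷ q) = ∣p∪q∣+∣p∩q∣≡∣p∣+∣q∣ p q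

∣p∪q∣≤∣p∣+∣q∣ : ∀ (p q : Subset N) → ∣ p ∪ q ∣ ≤ ∣ p ∣ + ∣ q ∣
∣p∪q∣≤∣p∣+∣q∣ p q = subst (∣ p ∪ q ∣ ≤_) (∣p∪q∣+∣p∩q∣≡∣p∣+∣q∣ p q) (m≤m+n _ _)

p∩q≢∅⇒∣p∪q∣<∣p∣+∣q∣ : ∀ (p q : Subset N) → Nonempty (p ∩ q) → ∣ p ∪ q ∣ < ∣ p ∣ + ∣ q ∣
p∩q≢∅⇒∣p∪q∣<∣p∣+∣q∣ p q (_ , m) = begin-strict
  ∣ p ∪ q ∣              ≡⟨ +-comm 0 _ ⟩
  ∣ p ∪ q ∣ + 0          <⟨ +-monoʳ-< ∣ p ∪ q ∣ (≤-trans (s≤s z≤n) (x∈p⇒∣p-x∣<∣p∣ m)) ⟩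
  ∣ p ∪ q ∣ + ∣ p ∩ q ∣  ≡⟨ ∣p∪q∣+∣p∩q∣≡∣p∣+∣q∣ p q ⟩
  ∣ p ∣ + ∣ q ∣          ∎
  where open ≤-Reasoning

x∈p⇒suc∣p-x∣≡∣p∣ : ∀ {p : Subset N} {x} → x ∈ p → suc ∣ p - x ∣ ≡ ∣ p ∣
x∈p⇒suc∣p-x∣≡∣p∣ {p = inside  ∷ p} {zero}  here      = cong (suc ∘ ∣_∣) (p─⊥≡p p)
x∈p⇒suc∣p-x∣≡∣p∣ {p = inside  ∷ p} {suc x} (there m) = cong suc (x∈p⇒suc∣p-x∣≡∣p∣ m)
x∈p⇒suc∣p-x∣≡∣p∣ {p = outside ∷ p} {suc x} (there m) = x∈p⇒suc∣p-x∣≡∣p∣ m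

x∉p⇒∣p∪⁅x⁆∣≡suc∣p∣ : ∀ {p : Subset N} {x} → x ∉ p → ∣ p ∪ ⁅ x ⁆ ∣ ≡ suc ∣ p ∣
x∉p⇒∣p∪⁅x⁆∣≡suc∣p∣ {p = inside  ∷ p} {zero}  x∉p = ⊥-elim (x∉p here)
x∉p⇒∣p∪⁅x⁆∣≡suc∣p∣ {p = outside ∷ p} {zero}  _   = cong (suc ∘ ∣_∣) (∪-identityʳ p)
x∉p⇒∣p∪⁅x⁆∣≡suc∣p∣ {p = inside  ∷ p} {suc x} x∉p = cong suc (x∉p⇒∣p∪⁅x⁆∣≡suc∣p∣ (x∉p ∘ there))
x∉p⇒∣p∪⁅x⁆∣≡suc∣p∣ {p = outside ∷ p} {suc x} x∉p = x∉p⇒∣p∪⁅x⁆∣≡suc∣p∣ (x∉p ∘ there)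

⊆-ofSize : ∀ m (p : Subset N) → m ≤ ∣ p ∣ → ∃ λ q → q ⊆ p × ∣ q ∣ ≡ m
⊆-ofSize {N} zero p _ = ⊥ , (λ x∈⊥ → ⊥-elim (∉⊥ x∈⊥)) , ∣⊥∣≡0 N
⊆-ofSize (suc m) (inside ∷ p) (s≤s m≤∣p∣) with ⊆-ofSize m p m≤∣p∣
... | q , q⊆p , ∣q∣ = inside ∷ q , in⊆in q⊆p , cong suc ∣q∣
⊆-ofSize (suc m) (outside ∷ p) m≤∣p∣ with ⊆-ofSize (suc m) p m≤∣p∣
... | q , q⊆p , ∣q∣ = outside ∷ q , out⊆ q⊆p , ∣q∣

∣p∣<∣q∣⇒∃∈q∉p : ∀ {p q : Subset N} → ∣ p ∣ < ∣ q ∣ → ∃ λ e → e ∈ q × e ∉ p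
∣p∣<∣q∣⇒∃∈q∉p {p = p} {q} ∣p∣<∣q∣ with any? (λ e → (e ∈? q) ×-dec (¬? (e ∈? p)))
... | yes witness = witness
... | no none     = ⊥-elim (<⇒≱ ∣p∣<∣q∣ (p⊆q⇒∣p∣≤∣q∣ q⊆p))
  where
  q⊆p : q ⊆ p
  q⊆p {e} e∈q with e ∈? p
  ... | yes e∈p = e∈p
  ... | no  e∉p = ⊥-elim (none (e , e∈q , e∉p))

2≤∣p∣⇒∃≢ : ∀ {p : Subset N} → 2 ≤ ∣ p ∣ → ∀ a → ∃ λ e → e ∈ p × e ≢ a
2≤∣p∣⇒∃≢ 2≤∣p∣ a with ∣p∣<∣q∣⇒∃∈q∉p (subst (_< _) (sym (∣⁅x⁆∣≡1 a)) 2≤∣p∣)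
... | e , e∈p , e∉⁅a⁆ = e , e∈p , x∉⁅y⁆⇒x≢y e∉⁅a⁆

3≤∣p∣⇒∃≢≢ : ∀ {p : Subset N} → 3 ≤ ∣ p ∣ → ∀ a b → ∃ λ e → e ∈ p × e ≢ a × e ≢ b
3≤∣p∣⇒∃≢≢ 3≤∣p∣ a b with ∣p∣<∣q∣⇒∃∈q∉p (≤-trans (s≤s ∣⁅a⁆∪⁅b⁆∣≤2) 3≤∣p∣)
  where
  ∣⁅a⁆∪⁅b⁆∣≤2 : ∣ ⁅ a ⁆ ∪ ⁅ b ⁆ ∣ ≤ 2
  ∣⁅a⁆∪⁅b⁆∣≤2 = subst (∣ ⁅ a ⁆ ∪ ⁅ b ⁆ ∣ ≤_) (cong₂ _+_ (∣⁅x⁆∣≡1 a) (∣⁅x⁆∣≡1 b))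
    (∣p∪q∣≤∣p∣+∣q∣ ⁅ a ⁆ ⁅ b ⁆)
... | e , e∈p , e∉⁅a⁆∪⁅b⁆ =
  e , e∈p , (λ { refl → e∉⁅a⁆∪⁅b⁆ (x∈p∪q⁺ (inj₁ (x∈⁅x⁆ a))) })
          , (λ { refl → e∉⁅a⁆∪⁅b⁆ (x∈p∪q⁺ (inj₂ (x∈⁅x⁆ b))) })

Disjoint : Subset N → Subset N → Set
Disjoint p q = ∀ {e} → e ∈ p → e ∉ q

Disjoint-sym : ∀ {p q : Subset N} → Disjoint p q → Disjoint q p
Disjoint-sym p#q e∈q e∈p = p#q e∈p e∈q

Disjoint-∪ˡ : ∀ {p q r : Subset N} → Disjoint p (q ∪ r) → Disjoint p q
Disjoint-∪ˡ p#q∪r e∈p e∈q = p#q∪r e∈p (x∈p∪q⁺ (inj₁ e∈q))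

Disjoint-∪ʳ : ∀ {p q r : Subset N} → Disjoint p (q ∪ r) → Disjoint p r
Disjoint-∪ʳ p#q∪r e∈p e∈r = p#q∪r e∈p (x∈p∪q⁺ (inj₂ e∈r))

Disjoint-∪⁅⁆ : ∀ {p q : Subset N} {a} → Disjoint p q → a ∉ q → Disjoint (p ∪ ⁅ a ⁆) q
Disjoint-∪⁅⁆ p#q a∉q e∈p∪⁅a⁆ with x∈p∪⁅y⁆⁻ e∈p∪⁅a⁆
... | inj₁ e∈p = p#q e∈p
... | inj₂ refl = a∉q

Disjoint-⊆ : ∀ {p q r : Subset N} → r ⊆ p → Disjoint p q → Disjoint r q
Disjoint-⊆ r⊆p p#q e∈r = p#q (r⊆p e∈r)

∃-Disjoint-ofSize : ∀ (p : Subset N) m → m + ∣ p ∣ ≤ N → ∃ λ q → Disjoint q p × ∣ q ∣ ≡ m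
∃-Disjoint-ofSize {N} p m m+∣p∣≤N
  with ⊆-ofSize m (∁ p) (subst (m ≤_) (sym (∣∁p∣≡n∸∣p∣ p)) (m+n≤o⇒m≤o∸n m m+∣p∣≤N))
... | q , q⊆∁p , ∣q∣ = q , (λ e∈q → x∈∁p⇒x∉p (q⊆∁p e∈q)) , ∣q∣

Disjoint⇒Adj : ∀ {u v : KVertex N n} → Disjoint (proj₁ u) (proj₁ v) → Adj u v
Disjoint⇒Adj u#v _ (e∈u , e∈v) = u#v e∈u e∈v

Walk-0⇒≡ : ∀ {u v : KVertex N n} → Walk u v 0 → u ≡ v
Walk-0⇒≡ here = refl

convex-commonNeighbour : ∀ {C : VSet N n} → Convex C → ∀ {u v w} → C u → C v →
  ∀ {a b} → a ∈ proj₁ u → a ∈ proj₁ v → b ∈ proj₁ u → b ∉ proj₁ v →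
  Disjoint (proj₁ u) (proj₁ w) → Disjoint (proj₁ v) (proj₁ w) → C w
convex-commonNeighbour (interval⊆C , _) {u} {v} {w} u∈C v∈C {a} {b} a∈u a∈v b∈u b∉v u#w v#w =
  interval⊆C w (u , v , u∈C , v∈C , 1 , 1 ,
    step (Disjoint⇒Adj {u = u} {w} u#w) here , step (Disjoint⇒Adj {u = w} {v} (Disjoint-sym v#w)) here ,
    2≤distance)
  where
  2≤distance : ∀ m → Walk u v m → 2 ≤ m
  2≤distance zero          walk             = ⊥-elim (b∉v (subst (λ s → b ∈ proj₁ s) (Walk-0⇒≡ walk) b∈u))
  2≤distance (suc zero)    (step adj here) = ⊥-elim (adj a (a∈u , a∈v))
  2≤distance (suc (suc m)) _               = s≤s (s≤s z≤n)

delete : ∀ (p : Subset N) → ∣ p ∣ ≡ suc n → ∀ {x} → x ∈ p → KVertex N n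
delete p ∣p∣ {x} x∈p = p - x , suc-injective (trans (x∈p⇒suc∣p-x∣≡∣p∣ x∈p) ∣p∣)

-- Any two n-subsets of an (n + 1)-set share an element (as n ≥ 2), hence are at distance 2.
convex-commonNeighbour-delete : ∀ {C : VSet N n} → Convex C → 2 ≤ n →
  ∀ {U} (∣U∣ : ∣ U ∣ ≡ suc n) {p q} (p∈U : p ∈ U) (q∈U : q ∈ U) → p ≢ q →
  C (delete U ∣U∣ p∈U) → C (delete U ∣U∣ q∈U) →
  ∀ w → Disjoint U (proj₁ w) → C w
convex-commonNeighbour-delete convex 2≤n {U} ∣U∣ {p} {q} p∈U q∈U p≢q U-p∈C U-q∈C w U#w
  with 3≤∣p∣⇒∃≢≢ (subst (3 ≤_) (sym ∣U∣) (s≤s 2≤n)) p q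
... | r , r∈U , r≢p , r≢q =
  convex-commonNeighbour convex U-p∈C U-q∈C
    (x∈p∧x≢y⇒x∈p-y r∈U r≢p) (x∈p∧x≢y⇒x∈p-y r∈U r≢q) (x∈p∧x≢y⇒x∈p-y q∈U (p≢q ∘ sym)) x∉p-x
    (Disjoint-⊆ (p─q⊆p U ⁅ p ⁆) U#w) (Disjoint-⊆ (p─q⊆p U ⁅ q ⁆) U#w)

∉p─q⇒∈p⇒∈q : ∀ {p q : Subset N} {x} → x ∉ p ─ q → x ∈ p → x ∈ q
∉p─q⇒∈p⇒∈q {q = q} {x} x∉p─q x∈p with x ∈? q
... | yes x∈q = x∈q
... | no  x∉q = ⊥-elim (x∉p─q (x∈p∧x∉q⇒x∈p─q x∈p x∉q))

∉symDiff⇒cyclic : ∀ {p q r : Subset N} {e} → e ∉ ((p ∪ q) ∪ r) ─ ((p ∩ q) ∩ r) →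
  (e ∈ p → e ∈ q) × (e ∈ q → e ∈ r) × (e ∈ r → e ∈ p)
∉symDiff⇒cyclic {p = p} {q} {r} {e} e∉symDiff =
  (λ e∈p → proj₁ (proj₂ (in-all (x∈p∪q⁺ (inj₁ (x∈p∪q⁺ (inj₁ e∈p)))))))
  , (λ e∈q → proj₂ (proj₂ (in-all (x∈p∪q⁺ (inj₁ (x∈p∪q⁺ (inj₂ e∈q)))))))
  , (λ e∈r → proj₁ (in-all (x∈p∪q⁺ (inj₂ e∈r))))
  where
  in-all : e ∈ (p ∪ q) ∪ r → e ∈ p × e ∈ q × e ∈ r
  in-all e∈p∪q∪r with x∈p∩q⁻ (p ∩ q) r (∉p─q⇒∈p⇒∈q e∉symDiff e∈p∪q∪r)
  ... | e∈p∩q , e∈r = proj₁ (x∈p∩q⁻ p q e∈p∩q) , proj₂ (x∈p∩q⁻ p q e∈p∩q) , e∈r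

≢⇒∉⁅⁆∪⁅⁆∪⁅⁆ : ∀ {a b c e : Fin N} → e ≢ a → e ≢ b → e ≢ c → e ∉ (⁅ a ⁆ ∪ ⁅ b ⁆) ∪ ⁅ c ⁆
≢⇒∉⁅⁆∪⁅⁆∪⁅⁆ {a = a} {b} {c} e≢a e≢b e≢c m with x∈p∪q⁻ (⁅ a ⁆ ∪ ⁅ b ⁆) ⁅ c ⁆ m
... | inj₂ e∈⁅c⁆ = e≢c (x∈⁅y⁆⇒x≡y c e∈⁅c⁆)
... | inj₁ e∈⁅a⁆∪⁅b⁆ with x∈p∪q⁻ ⁅ a ⁆ ⁅ b ⁆ e∈⁅a⁆∪⁅b⁆
...   | inj₁ e∈⁅a⁆ = e≢a (x∈⁅y⁆⇒x≡y a e∈⁅a⁆)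
...   | inj₂ e∈⁅b⁆ = e≢b (x∈⁅y⁆⇒x≡y b e∈⁅b⁆)

record Triangle (N n : ℕ) : Set where
  field
    x y z : KVertex N n
    h i j : Fin N
    h∈x : h ∈ proj₁ x
    h∉y : h ∉ proj₁ y
    h∉z : h ∉ proj₁ z
    i∉x : i ∉ proj₁ x
    i∈y : i ∈ proj₁ y
    i∉z : i ∉ proj₁ z
    j∉x : j ∉ proj₁ x
    j∉y : j ∉ proj₁ y
    j∈z : j ∈ proj₁ z
    agree : ∀ e → e ≢ h → e ≢ i → e ≢ j →
      (e ∈ proj₁ x → e ∈ proj₁ y) × (e ∈ proj₁ y → e ∈ proj₁ z) × (e ∈ proj₁ z → e ∈ proj₁ x)

rotate : Triangle N n → Triangle N n
rotate t = record
  { x = y ; y = z ; z = x ; h = i ; i = j ; j = h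
  ; h∈x = i∈y ; h∉y = i∉z ; h∉z = i∉x
  ; i∉x = j∉y ; i∈y = j∈z ; i∉z = j∉x
  ; j∉x = h∉y ; j∉y = h∉z ; j∈z = h∈x
  ; agree = λ e e≢i e≢j e≢h → let x⇒y , y⇒z , z⇒x = agree e e≢h e≢i e≢j in y⇒z , z⇒x , x⇒y
  }
  where open Triangle t

module DisjointFromX (2≤n : 2 ≤ n) (room : (n ∸ 1) + (n + n) ≤ N) {C : VSet N n} (convex : Convex C)
  (t : Triangle N n) (x∈C : C (Triangle.x t)) (y∈C : C (Triangle.y t)) (z∈C : C (Triangle.z t)) where

  open Triangle t

  X Y Z : Subset N
  X = proj₁ x
  Y = proj₁ y
  Z = proj₁ z

  x⇒y : ∀ {e} → e ∈ X → e ≢ h → e ∈ Y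
  x⇒y e∈X e≢h = proj₁ (agree _ e≢h (∈∉⇒≢ e∈X i∉x) (∈∉⇒≢ e∈X j∉x)) e∈X

  x⇒z : ∀ {e} → e ∈ X → e ≢ h → e ∈ Z
  x⇒z e∈X e≢h = proj₁ (proj₂ (agree _ e≢h (∈∉⇒≢ e∈X i∉x) (∈∉⇒≢ e∈X j∉x))) (x⇒y e∈X e≢h)

  y⇒x : ∀ {e} → e ∈ Y → e ≢ i → e ∈ X
  y⇒x e∈Y e≢i =
    let _ , y⇒z , z⇒x = agree _ (∈∉⇒≢ e∈Y h∉y) e≢i (∈∉⇒≢ e∈Y j∉y) in z⇒x (y⇒z e∈Y)

  z⇒x : ∀ {e} → e ∈ Z → e ≢ j → e ∈ X
  z⇒x e∈Z e≢j = proj₂ (proj₂ (agree _ (∈∉⇒≢ e∈Z h∉z) (∈∉⇒≢ e∈Z i∉z) e≢j)) e∈Z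

  #x⇒#y : ∀ {S} → Disjoint S X → i ∉ S → Disjoint S Y
  #x⇒#y S#X i∉S {e} e∈S e∈Y with e ≟ i
  ... | yes refl = i∉S e∈S
  ... | no  e≢i  = S#X e∈S (y⇒x e∈Y e≢i)

  #x⇒#z : ∀ {S} → Disjoint S X → j ∉ S → Disjoint S Z
  #x⇒#z S#X j∉S {e} e∈S e∈Z with e ≟ j
  ... | yes refl = j∉S e∈S
  ... | no  e≢j  = S#X e∈S (z⇒x e∈Z e≢j)

  common : ∃ λ c → c ∈ X × c ≢ h
  common = 2≤∣p∣⇒∃≢ (subst (2 ≤_) (sym (proj₂ x)) 2≤n) h

  c : Fin N
  c = proj₁ common

  c∈X : c ∈ X
  c∈X = proj₁ (proj₂ common)

  c≢h : c ≢ h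
  c≢h = proj₂ (proj₂ common)

  room-pred : ∀ {s} → s ≤ n + n → (n ∸ 1) + s ≤ N
  room-pred s≤2n = ≤-trans (+-monoʳ-≤ (n ∸ 1) s≤2n) room

  suc[n∸1]≡n : suc (n ∸ 1) ≡ n
  suc[n∸1]≡n = trans (+-comm 1 (n ∸ 1)) (m∸n+n≡m (≤-trans (s≤s z≤n) 2≤n))

  [n∸1]+suc≡n+ : ∀ s → (n ∸ 1) + suc s ≡ n + s
  [n∸1]+suc≡n+ s = trans (+-suc (n ∸ 1) s) (cong (_+ s) suc[n∸1]≡n)

  room-n : ∀ {s} → suc s ≤ n + n → n + s ≤ N
  room-n {s} s<2n = subst (_≤ N) ([n∸1]+suc≡n+ s) (room-pred s<2n)

  room-suc-n : ∀ {s} → suc (suc s) ≤ n + n → suc n + s ≤ N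
  room-suc-n {s} s+1<2n = subst (_≤ N) (trans ([n∸1]+suc≡n+ (suc s)) (+-suc n s)) (room-pred s+1<2n)

  disjoint-x⇒∈C : ∀ w → Disjoint (proj₁ w) X → C w
  disjoint-x⇒∈C w W#X with i ∈? proj₁ w | j ∈? proj₁ w
  ... | no i∉W | _ =
    convex-commonNeighbour convex x∈C y∈C c∈X (x⇒y c∈X c≢h) h∈x h∉y
      (Disjoint-sym W#X) (Disjoint-sym (#x⇒#y W#X i∉W))
  ... | yes _ | no j∉W =
    convex-commonNeighbour convex x∈C z∈C c∈X (x⇒z c∈X c≢h) h∈x h∉z
      (Disjoint-sym W#X) (Disjoint-sym (#x⇒#z W#X j∉W))
  ... | yes i∈W | yes j∈W with ∃-Disjoint-ofSize (X ∪ proj₁ w) (n ∸ 1) (room-pred X∪W≤2n)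
    where
    X∪W≤2n : ∣ X ∪ proj₁ w ∣ ≤ n + n
    X∪W≤2n = subst (∣ X ∪ proj₁ w ∣ ≤_) (cong₂ _+_ (proj₂ x) (proj₂ w)) (∣p∪q∣≤∣p∣+∣q∣ X (proj₁ w))
  ... | V , V#X∪W , ∣V∣ =
    convex-commonNeighbour convex x∈C v∈C h∈x (x∈p∪q⁺ (inj₂ (x∈⁅x⁆ h))) c∈X c∉v
      (Disjoint-sym W#X) (Disjoint-∪⁅⁆ V#W (λ h∈W → W#X h∈W h∈x))
    where
    V#X : Disjoint V X
    V#X = Disjoint-∪ˡ V#X∪W
    V#W : Disjoint V (proj₁ w)
    V#W = Disjoint-∪ʳ V#X∪W
    v : KVertex N n
    v = V ∪ ⁅ h ⁆ , trans (x∉p⇒∣p∪⁅x⁆∣≡suc∣p∣ (λ h∈V → V#X h∈V h∈x))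
                          (trans (cong suc ∣V∣) suc[n∸1]≡n)
    v∈C : C v
    v∈C = convex-commonNeighbour convex y∈C z∈C (x⇒y c∈X c≢h) (x⇒z c∈X c≢h) i∈y i∉z
      (Disjoint-sym (Disjoint-∪⁅⁆ (#x⇒#y V#X (λ i∈V → V#W i∈V i∈W)) h∉y))
      (Disjoint-sym (Disjoint-∪⁅⁆ (#x⇒#z V#X (λ j∈V → V#W j∈V j∈W)) h∉z))
    c∉v : c ∉ V ∪ ⁅ h ⁆
    c∉v c∈v with x∈p∪⁅y⁆⁻ c∈v
    ... | inj₁ c∈V = V#X c∈V c∈X
    ... | inj₂ c≡h = c≢h c≡h

module HullOfTriangle (2≤n : 2 ≤ n) (room : (n ∸ 1) + (n + n) ≤ N) {C : VSet N n} (convex : Convex C)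
  (t : Triangle N n) (x∈C : C (Triangle.x t)) (y∈C : C (Triangle.y t)) (z∈C : C (Triangle.z t)) where

  open Triangle t

  open DisjointFromX 2≤n room convex t x∈C y∈C z∈C
  open DisjointFromX 2≤n room convex (rotate t) y∈C z∈C x∈C using () renaming (disjoint-x⇒∈C to disjoint-y⇒∈C)

  K : Subset N
  K = X - h

  suc∣K∣≡n : suc ∣ K ∣ ≡ n
  suc∣K∣≡n = trans (x∈p⇒suc∣p-x∣≡∣p∣ h∈x) (proj₂ x)

  c∈K : c ∈ K
  c∈K = x∈p∧x≢y⇒x∈p-y c∈X c≢h

  #K⇒#x : ∀ {S} → Disjoint S K → h ∉ S → Disjoint S X
  #K⇒#x S#K h∉S {e} e∈S e∈X with e ≟ h
  ... | yes refl = h∉S e∈S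
  ... | no  e≢h  = S#K e∈S (x∈p∧x≢y⇒x∈p-y e∈X e≢h)

  #K⇒#y : ∀ {S} → Disjoint S K → i ∉ S → Disjoint S Y
  #K⇒#y S#K i∉S {e} e∈S e∈Y with e ≟ i
  ... | yes refl = i∉S e∈S
  ... | no  e≢i  = S#K e∈S (x∈p∧x≢y⇒x∈p-y (y⇒x e∈Y e≢i) (∈∉⇒≢ e∈Y h∉y))

  delete-∌h⇒∈C : ∀ {U} (∣U∣ : ∣ U ∣ ≡ suc n) → Disjoint U K →
    ∀ {p} (p∈U : p ∈ U) → h ∉ U - p → C (delete U ∣U∣ p∈U)
  delete-∌h⇒∈C {U} ∣U∣ U#K {p} p∈U h∉U-p =
    disjoint-x⇒∈C _ (#K⇒#x (Disjoint-⊆ (p─q⊆p U ⁅ p ⁆) U#K) h∉U-p)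

  delete-∌i⇒∈C : ∀ {U} (∣U∣ : ∣ U ∣ ≡ suc n) → Disjoint U K →
    ∀ {p} (p∈U : p ∈ U) → i ∉ U - p → C (delete U ∣U∣ p∈U)
  delete-∌i⇒∈C {U} ∣U∣ U#K {p} p∈U i∉U-p =
    disjoint-y⇒∈C _ (#K⇒#y (Disjoint-⊆ (p─q⊆p U ⁅ p ⁆) U#K) i∉U-p)

  -- Among the n-subsets of U, only those containing both h and i can fail to lie in C.
  disjoint-suc-n-set⇒∈C : ∀ {U} → ∣ U ∣ ≡ suc n → Disjoint U K → ∀ w → Disjoint U (proj₁ w) → C w
  disjoint-suc-n-set⇒∈C {U} ∣U∣ U#K w U#W = by-cases (h ∈? U) (i ∈? U)
    where
    2≤∣U∣ : 2 ≤ ∣ U ∣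
    2≤∣U∣ = subst (2 ≤_) (sym ∣U∣) (≤-trans 2≤n (n≤1+n n))

    pair : ∀ {p q} (p∈U : p ∈ U) (q∈U : q ∈ U) → p ≢ q →
      C (delete U ∣U∣ p∈U) → C (delete U ∣U∣ q∈U) → C w
    pair p∈U q∈U p≢q U-p∈C U-q∈C =
      convex-commonNeighbour-delete convex 2≤n ∣U∣ p∈U q∈U p≢q U-p∈C U-q∈C w U#W

    by-cases : Dec (h ∈ U) → Dec (i ∈ U) → C w
    by-cases (yes h∈U) (yes i∈U) =
      pair h∈U i∈U (∈∉⇒≢ h∈x i∉x) (delete-∌h⇒∈C ∣U∣ U#K h∈U x∉p-x) (delete-∌i⇒∈C ∣U∣ U#K i∈U x∉p-x)
    by-cases (yes h∈U) (no i∉U) =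
      let q , q∈U , q≢h = 2≤∣p∣⇒∃≢ 2≤∣U∣ h in
      pair h∈U q∈U (q≢h ∘ sym) (delete-∌h⇒∈C ∣U∣ U#K h∈U x∉p-x)
        (delete-∌i⇒∈C ∣U∣ U#K q∈U (λ i∈U-q → i∉U (proj₁ (x∈p-y⁻ i∈U-q))))
    by-cases (no h∉U) _ =
      let p , p∈U , _ = 2≤∣p∣⇒∃≢ 2≤∣U∣ h
          q , q∈U , q≢p = 2≤∣p∣⇒∃≢ 2≤∣U∣ p
      in
      pair p∈U q∈U (q≢p ∘ sym)
        (delete-∌h⇒∈C ∣U∣ U#K p∈U (λ h∈U-p → h∉U (proj₁ (x∈p-y⁻ h∈U-p))))
        (delete-∌h⇒∈C ∣U∣ U#K q∈U (λ h∈U-q → h∉U (proj₁ (x∈p-y⁻ h∈U-q))))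

  meets-K⇒∈C : ∀ w → Nonempty (proj₁ w ∩ K) → C w
  meets-K⇒∈C w meets with ∃-Disjoint-ofSize (W ∪ K) (suc n) (room-suc-n W∪K+1<2n)
    where
    W = proj₁ w
    W∪K+1<2n : suc (suc ∣ W ∪ K ∣) ≤ n + n
    W∪K+1<2n = begin
      suc (suc ∣ W ∪ K ∣) ≤⟨ s≤s (p∩q≢∅⇒∣p∪q∣<∣p∣+∣q∣ W K meets) ⟩
      suc (∣ W ∣ + ∣ K ∣) ≡⟨ sym (+-suc ∣ W ∣ ∣ K ∣) ⟩
      ∣ W ∣ + suc ∣ K ∣   ≡⟨ cong₂ _+_ (proj₂ w) suc∣K∣≡n ⟩
      n + n               ∎
      where open ≤-Reasoning
  ... | U , U#W∪K , ∣U∣ = disjoint-suc-n-set⇒∈C ∣U∣ (Disjoint-∪ʳ U#W∪K) w (Disjoint-∪ˡ U#W∪K)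

  -- Here the (n + 1)-set is V ∪ {c} with c ∈ K, so the deletion of c misses x and the others meet K.
  ∋h⇒∈C : ∀ w → h ∈ proj₁ w → Empty (proj₁ w ∩ K) → C w
  ∋h⇒∈C w h∈W misses with ∃-Disjoint-ofSize (proj₁ w ∪ X) n (room-n W∪X<2n)
    where
    W∪X<2n : suc ∣ proj₁ w ∪ X ∣ ≤ n + n
    W∪X<2n = subst (suc ∣ proj₁ w ∪ X ∣ ≤_) (cong₂ _+_ (proj₂ w) (proj₂ x))
      (p∩q≢∅⇒∣p∪q∣<∣p∣+∣q∣ (proj₁ w) X (h , x∈p∩q⁺ (h∈W , h∈x)))
  ... | V , V#W∪X , ∣V∣ with 2≤∣p∣⇒∃≢ (subst (2 ≤_) (sym ∣V∣) 2≤n) c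
  ... | e , e∈V , e≢c =
    convex-commonNeighbour-delete convex 2≤n ∣U∣ c∈U e∈U (e≢c ∘ sym) U-c∈C U-e∈C w U#W
    where
    U : Subset N
    U = V ∪ ⁅ c ⁆
    V#X : Disjoint V X
    V#X = Disjoint-∪ʳ V#W∪X
    ∣U∣ : ∣ U ∣ ≡ suc n
    ∣U∣ = trans (x∉p⇒∣p∪⁅x⁆∣≡suc∣p∣ (λ c∈V → V#X c∈V c∈X)) (cong suc ∣V∣)
    c∈U : c ∈ U
    c∈U = x∈p∪q⁺ (inj₂ (x∈⁅x⁆ c))
    e∈U : e ∈ U
    e∈U = x∈p∪q⁺ (inj₁ e∈V)
    U#W : Disjoint U (proj₁ w)
    U#W = Disjoint-∪⁅⁆ (Disjoint-∪ˡ V#W∪X) (λ c∈W → misses (c , x∈p∩q⁺ (c∈W , c∈K)))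
    U-c∈C : C (delete U ∣U∣ c∈U)
    U-c∈C = disjoint-x⇒∈C _ (Disjoint-⊆ [p∪⁅x⁆]-x⊆p V#X)
    U-e∈C : C (delete U ∣U∣ e∈U)
    U-e∈C = meets-K⇒∈C _ (c , x∈p∩q⁺ (x∈p∧x≢y⇒x∈p-y c∈U (e≢c ∘ sym) , c∈K))

  all∈C : ∀ w → C w
  all∈C w with nonempty? (proj₁ w ∩ K) | h ∈? proj₁ w
  ... | yes meets  | _       = meets-K⇒∈C w meets
  ... | no  misses | yes h∈W = ∋h⇒∈C w h∈W misses
  ... | no  misses | no  h∉W =
    disjoint-x⇒∈C w (#K⇒#x (λ e∈W e∈K → misses (_ , x∈p∩q⁺ (e∈W , e∈K))) h∉W)

n∸1≤k⇒room : ∀ n k → n ∸ 1 ≤ k → (n ∸ 1) + (n + n) ≤ 2 * n + k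
n∸1≤k⇒room n k n∸1≤k = ≤-trans (+-monoˡ-≤ (n + n) n∸1≤k)
  (≤-reflexive (trans (+-comm k (n + n)) (cong (λ m → n + m + k) (sym (+-identityʳ n)))))

lemma8 : (n k : ℕ) → 2 ≤ n → 1 ≤ k → n ∸ 1 ≤ k →
    (x y z : KVertex (2 * n + k) n) → (h i j : Fin (2 * n + k)) →
    h ≢ i → h ≢ j → i ≢ j →
    ((proj₁ x ∪ proj₁ y) ∪ proj₁ z) ─ ((proj₁ x ∩ proj₁ y) ∩ proj₁ z) ≡ (⁅ h ⁆ ∪ ⁅ i ⁆) ∪ ⁅ j ⁆ →
    h ∈ proj₁ x → h ∉ proj₁ y → h ∉ proj₁ z →
    i ∉ proj₁ x → i ∈ proj₁ y → i ∉ proj₁ z →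
    j ∉ proj₁ x → j ∉ proj₁ y → j ∈ proj₁ z →
    GeodeticHullSet (Three x y z)
-- Positivity of k and distinctness of h, i, j follow from the remaining hypotheses.
lemma8 n k 2≤n _ n∸1≤k x y z h i j _ _ _ symDiff h∈x h∉y h∉z i∉x i∈y i∉z j∉x j∉y j∈z
       w C convex xyz⊆C =
  HullOfTriangle.all∈C 2≤n (n∸1≤k⇒room n k n∸1≤k) convex triangle
    (xyz⊆C x (inj₁ refl)) (xyz⊆C y (inj₂ (inj₁ refl))) (xyz⊆C z (inj₂ (inj₂ refl))) w
  where
  triangle : Triangle (2 * n + k) n
  triangle = record
    { x = x ; y = y ; z = z ; h = h ; i = i ; j = j
    ; h∈x = h∈x ; h∉y = h∉y ; h∉z = h∉z
    ; i∉x = i∉x ; i∈y = i∈y ; i∉z = i∉z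
    ; j∉x = j∉x ; j∉y = j∉y ; j∈z = j∈z
    ; agree = λ e e≢h e≢i e≢j →
        ∉symDiff⇒cyclic (subst (e ∉_) (sym symDiff) (≢⇒∉⁅⁆∪⁅⁆∪⁅⁆ e≢h e≢i e≢j))
    }
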